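{- Consider a normalized instance of \textsc{Constrained Layer Tree}. For every Pareto-optimal relaxed partial solution $c$ with $c_0>1$ leaves and branching layer $k$, there are Pareto-optimal relaxed partial solutions $a$ and $b$ with $a_0$ and $b_0$ leaves, respectively, such that $a_0\ge c_0/3$, $b_0\ge c_0/3$, and $c$ is the $k$-combination of $a$ and $b$.
   Context: A layer tree with layers $0,\dots,\lambda$ is a rooted tree whose leaves are in layer $0$, with exactly one root in layer $\lambda$, every edge going from a vertex in layer $i-1$ to its parent in layer $i$. The weight $w(v)$ of a vertex is the number of leaves in its subtree. An instance of \textsc{Constrained Layer Tree} is given by nonnegative integers $n_0$ and $(n_i,\ell_i,u_i)_{i\in\{1,\dots,\lambda\}}$, with the convention $\ell_0=u_0=1$. The instance is normalized if $n_i\le n_{i-1}$, $\ell_i\ge\ell_{i-1}$, $u_i\ge u_{i-1}$ for all $i\in\{1,\dots,\lambda\}$. The branching layer of a layer tree (or of a vector $a\in\mathbb N^{\lambda+1}$) is the highest layer $i$ with more than one vertex (resp. $a_i>1$), and $0$ if no such layer exists. A layer tree with branching layer $k$ is almost valid if it has at most $n_i$ vertices in each layer $i$, every vertex $v$ in a layer $i\in\{1,\dots,k\}$ satisfies $\ell_i\le w(v)\le u_i$, and the number of leaves is at most $u_i$ for each $i\in\{k+1,\dots,\lambda\}$. A vector $a=(a_0,\dots,a_\lambda)$ is a relaxed partial solution (with $a_0$ leaves) if there is an almost valid layer tree with exactly $a_i$ vertices in layer $i$ for each $i$. For such vectors $a,b$ with branching layers $k_a,k_b$ and $k\in\{\max\{k_a,k_b\},\dots,\lambda\}$,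 the $k$-combination of $a$ and $b$ is $(a_0+b_0,\dots,a_k+b_k,1,\dots,1)$. For two different relaxed partial solutions $a,b$ with $a_0=b_0$, $a$ dominates $b$ if $a_i\le b_i$ for all $i\in\{1,\dots,\lambda\}$; a relaxed partial solution is Pareto-optimal if no relaxed partial solution dominates it. -}

module Defs where

open import Data.Nat using (ℕ; zero; suc; _+_; _*_; _≤_; _<_)
open import Data.Nat.Base using (_≡ᵇ_)
open import Data.Bool using (if_then_else_)
open import Data.Fin as F using (Fin; toℕ)
open import Data.Vec using (Vec; lookup; tabulate)
open import Data.List using (List; []; _∷_)
open import Data.Product using (Σ; _×_; ∃)
open import Data.Sum using (_⊎_)
open import Data.Unit using (⊤)
open import Relation.Binary.PropositionalEquality using (_≡_; _≢_)
open import Relation.Nullary using (¬_)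

-- Instances of Constrained Layer Tree
-- `layers` is λ; n i, ℓ i, u i are the bounds of layer i (values of n, ℓ, u
-- at indices > λ are irrelevant; values of ℓ, u at index 0 are replaced by
-- the convention ℓ₀ = u₀ = 1, see L and U).

record Instance : Set where
  field
    layers : ℕ
    n : ℕ → ℕ
    ℓ : ℕ → ℕ
    u : ℕ → ℕ

module _ (I : Instance) where
  open Instance I

  L : ℕ → ℕ
  L zero = 1
  L (suc i) = ℓ (suc i)

  U : ℕ → ℕ
  U zero = 1
  U (suc i) = u (suc i)

  Normalized : Set
  Normalized = ∀ j → suc j ≤ layers →
    (n (suc j) ≤ n j) × (L j ≤ L (suc j)) × (U j ≤ U (suc j))

-- Layer trees: LTree h is a tree whose root is in layer h; all leaves are in
-- layer 0, every vertex in layer i+1 has a nonempty list of children in layer i.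

data LTree : ℕ → Set where
  leaf : LTree 0
  node : ∀ {h} → LTree h → List (LTree h) → LTree (suc h)

mutual
  leaves : ∀ {h} → LTree h → ℕ
  leaves leaf = 1
  leaves (node t ts) = leaves t + leavesF ts

  leavesF : ∀ {h} → List (LTree h) → ℕ
  leavesF [] = 0
  leavesF (t ∷ ts) = leaves t + leavesF ts

mutual
  cnt : ∀ {h} → ℕ → LTree h → ℕ
  cnt i leaf = if i ≡ᵇ 0 then 1 else 0
  cnt {suc h} i (node t ts) = (if i ≡ᵇ suc h then 1 else 0) + cnt i t + cntF i ts

  cntF : ∀ {h} → ℕ → List (LTree h) → ℕ
  cntF i [] = 0
  cntF i (t ∷ ts) = cnt i t + cntF i ts

mutual
  AllV : (ℕ → ℕ → Set) → ∀ {h} → LTree h → Set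
  AllV P leaf = P 0 1
  AllV P {suc h} (node t ts) = P (suc h) (leaves (node t ts)) × AllV P t × AllVF P ts

  AllVF : (ℕ → ℕ → Set) → ∀ {h} → List (LTree h) → Set
  AllVF P [] = ⊤
  AllVF P (t ∷ ts) = AllV P t × AllVF P ts

profile : ∀ {λ'} → LTree λ' → Vec ℕ (suc λ')
profile t = tabulate (λ i → cnt (toℕ i) t)

Branching : ∀ {λ'} → Vec ℕ (suc λ') → Fin (suc λ') → Set
Branching a k =
  (∀ j → k F.< j → lookup a j ≤ 1) × ((toℕ k ≡ 0) ⊎ (1 < lookup a k))

module _ (I : Instance) where
  open Instance I

  AlmostValidWith : LTree layers → Fin (suc layers) → Set
  AlmostValidWith t k =
      (∀ (i : Fin (suc layers)) → cnt (toℕ i) t ≤ n (toℕ i))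
    × AllV (λ i w → 1 ≤ i → i ≤ toℕ k → (L I i ≤ w) × (w ≤ U I i)) t
    × (∀ (i : Fin (suc layers)) → k F.< i → leaves t ≤ U I (toℕ i))

  AlmostValid : LTree layers → Set
  AlmostValid t = Σ (Fin (suc layers)) λ k → Branching (profile t) k × AlmostValidWith t k

  RelaxedPartialSolution : Vec ℕ (suc layers) → Set
  RelaxedPartialSolution a = Σ (LTree layers) λ t → AlmostValid t × profile t ≡ a

  Dominates : Vec ℕ (suc layers) → Vec ℕ (suc layers) → Set
  Dominates a b =
      RelaxedPartialSolution a × RelaxedPartialSolution b × a ≢ b
    × lookup a F.zero ≡ lookup b F.zero
    × (∀ (i : Fin (suc layers)) → 1 ≤ toℕ i → lookup a i ≤ lookup b i)

  ParetoOptimal : Vec ℕ (suc layers) → Set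
  ParetoOptimal c = RelaxedPartialSolution c × (∀ a → ¬ Dominates a c)

combination : ∀ {λ'} → Fin (suc λ') → Vec ℕ (suc λ') → Vec ℕ (suc λ') → Vec ℕ (suc λ')
combination k a b = tabulate (λ i → if toℕ i Data.Nat.≤ᵇ toℕ k then lookup a i + lookup b i else 1)

{-# OPTIONS --safe #-}
-- Let the tree t realise c. Above its branching layer k, t is a single path (a stem) ending in a
-- vertex whose children form a forest F of at least two trees in layer k. Split F into two nonempty
-- forests A and B, each carrying at least a third of the leaves, without changing the number of
-- vertices per layer and keeping every weight inside its window [ℓᵢ, uᵢ]: if no tree of F is heavy
-- (more than two thirds of the leaves), collect trees greedily; otherwise move subtrees from the heavy
-- tree to a light partner, descending layer by layer, so that every new weight lies between two old
-- weights of the same layer. The stems over A and B give a and b with c the k-combination of a and b.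
-- If a′ dominated a, then grafting B onto the tree of a′, whose branching layer can be raised to k
-- because ℓ is monotone, would give a relaxed partial solution dominating c.
module Submission where

open import Defs
open import Data.Nat
  using (ℕ; zero; suc; _+_; _*_; _≤_; _<_; _≤′_; _<′_; ≤′-refl; ≤′-step; z≤n; s≤s)
open import Data.Nat using (_≡ᵇ_; _≤ᵇ_; _<?_; _≤?_)
open import Data.Nat.Properties
open import Data.Nat.Tactic.RingSolver using (solve-∀)
open import Data.Bool using (true; false; T; if_then_else_)
open import Data.Unit using (tt)
open import Data.Product using (Σ; ∃; ∃₂; _×_; _,_; proj₁; proj₂)
open import Data.Sum using (_⊎_; inj₁; inj₂; reduce)
open import Data.List using (List; []; _∷_; _++_; length)
open import Data.List.Properties using (++-assoc)
open import Data.List.NonEmpty using (List⁺; _∷_; head; tail; toList; _⁺++⁺_)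
open import Data.List.Relation.Unary.All using (All; []; _∷_)
open import Data.List.Relation.Binary.Pointwise using (≡⇒Pointwise-≡)
open import Data.List.Relation.Ternary.Interleaving.Propositional
  using (Interleaving; []; consˡ; consʳ; right)
open import Data.Fin as F using (Fin; toℕ; fromℕ<)
open import Data.Fin.Properties using (toℕ-fromℕ<; toℕ-injective; toℕ≤pred[n])
open import Data.Vec using (Vec; lookup)
open import Data.Vec.Properties using (lookup∘tabulate; tabulate-cong)
open import Data.Vec.Relation.Binary.Pointwise.Extensional using (ext; Pointwise-≡⇒≡)
open import Function using (_∘_)
open import Level using (0ℓ)
open import Relation.Binary.Bundles using (Setoid)
import Relation.Binary.Reasoning.Setoid as SetoidReasoning
open import Relation.Binary.PropositionalEquality
open import Relation.Nullary using (¬_; yes; no; contradiction)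

private variable
  h j : ℕ

indicator : ℕ → ℕ → ℕ
indicator i j = if i ≡ᵇ j then 1 else 0

indicator-≡ : ∀ i → indicator i i ≡ 1
indicator-≡ zero    = refl
indicator-≡ (suc i) = indicator-≡ i

indicator-≢ : ∀ {i j} → i ≢ j → indicator i j ≡ 0
indicator-≢ {i} {j} i≢j with i ≡ᵇ j in eq
... | true  = contradiction (≡ᵇ⇒≡ i j (subst T (sym eq) tt)) i≢j
... | false = refl

cnt-node : ∀ i (t : LTree h) ts → cnt i (node t ts) ≡ indicator i (suc h) + cntF i (t ∷ ts)
cnt-node i t ts = +-assoc (indicator i _) (cnt i t) (cntF i ts)

cnt-node-below : ∀ {i} (t : LTree h) ts → i ≤ h → cnt i (node t ts) ≡ cntF i (t ∷ ts)
cnt-node-below {i = i} t ts i≤h =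
  trans (cnt-node i t ts) (cong (_+ cntF i (t ∷ ts)) (indicator-≢ (<⇒≢ (s≤s i≤h))))

cnt-node-[] : ∀ {i} (t : LTree h) → i ≤ h → cnt i (node t []) ≡ cnt i t
cnt-node-[] t i≤h = trans (cnt-node-below t [] i≤h) (+-identityʳ _)

mutual
  cnt-above : ∀ {i} (t : LTree h) → h < i → cnt i t ≡ 0
  cnt-above {i = suc i} leaf _ = refl
  cnt-above {suc h} {i} (node t ts) h<i =
    trans (cnt-node i t ts) (cong₂ _+_ (indicator-≢ (>⇒≢ h<i)) (cntF-above (t ∷ ts) (<-trans (n<1+n h) h<i)))

  cntF-above : ∀ {i} (ts : List (LTree h)) → h < i → cntF i ts ≡ 0
  cntF-above []       _   = refl
  cntF-above (t ∷ ts) h<i = cong₂ _+_ (cnt-above t h<i) (cntF-above ts h<i)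

cnt-top : (t : LTree h) → cnt h t ≡ 1
cnt-top leaf = refl
cnt-top {suc h} (node t ts) =
  trans (cnt-node (suc h) t ts) (cong₂ _+_ (indicator-≡ (suc h)) (cntF-above (t ∷ ts) (n<1+n h)))

cnt-positive : ∀ {i} (t : LTree h) → i ≤ h → 0 < cnt i t
cnt-positive t i≤h with m≤n⇒m<n∨m≡n i≤h
... | inj₂ refl = ≤-reflexive (sym (cnt-top t))
cnt-positive (node t ts) _ | inj₁ (s≤s i≤h) =
  ≤-trans (cnt-positive t i≤h) (≤-trans (m≤m+n _ _) (≤-reflexive (sym (cnt-node-below t ts i≤h))))

length≤cntF : ∀ {i} (ts : List (LTree h)) → i ≤ h → length ts ≤ cntF i ts
length≤cntF []       _   = z≤n
length≤cntF (t ∷ ts) i≤h = +-mono-≤ (cnt-positive t i≤h) (length≤cntF ts i≤h)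

mutual
  cnt-zero : (t : LTree h) → cnt 0 t ≡ leaves t
  cnt-zero leaf        = refl
  cnt-zero (node t ts) = trans (cnt-node 0 t ts) (cntF-zero (t ∷ ts))

  cntF-zero : (ts : List (LTree h)) → cntF 0 ts ≡ leavesF ts
  cntF-zero []       = refl
  cntF-zero (t ∷ ts) = cong₂ _+_ (cnt-zero t) (cntF-zero ts)

cntF-++ : ∀ i (ts us : List (LTree h)) → cntF i (ts ++ us) ≡ cntF i ts + cntF i us
cntF-++ i []       us = refl
cntF-++ i (t ∷ ts) us = trans (cong (cnt i t +_) (cntF-++ i ts us)) (sym (+-assoc (cnt i t) _ _))

leavesF-++ : (ts us : List (LTree h)) → leavesF (ts ++ us) ≡ leavesF ts + leavesF us
leavesF-++ []       us = refl
leavesF-++ (t ∷ ts) us = trans (cong (leaves t +_) (leavesF-++ ts us)) (sym (+-assoc (leaves t) _ _))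

AllV-root : ∀ {P : ℕ → ℕ → Set} (t : LTree h) → AllV P t → P h (leaves t)
AllV-root leaf        Pt      = Pt
AllV-root (node _ _) (Pt , _) = Pt

module _ {P Q : ℕ → ℕ → Set} where
  mutual
    AllV-map : (∀ {i w} → i ≤ h → P i w → Q i w) → (t : LTree h) → AllV P t → AllV Q t
    AllV-map f leaf        Pt             = f z≤n Pt
    AllV-map f (node t ts) (Pr , Pt , Pts) = f ≤-refl Pr , AllV-map f′ t Pt , AllVF-map f′ ts Pts
      where
      f′ : ∀ {i w} → i ≤ _ → P i w → Q i w
      f′ i≤h = f (m≤n⇒m≤1+n i≤h)

    AllVF-map : (∀ {i w} → i ≤ h → P i w → Q i w) → (ts : List (LTree h)) → AllVF P ts → AllVF Q ts
    AllVF-map f []       _          = tt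
    AllVF-map f (t ∷ ts) (Pt , Pts) = AllV-map f t Pt , AllVF-map f ts Pts

module _ {P : ℕ → ℕ → Set} where
  AllVF-++ : (ts us : List (LTree h)) → AllVF P ts → AllVF P us → AllVF P (ts ++ us)
  AllVF-++ []       us _          Pus = Pus
  AllVF-++ (t ∷ ts) us (Pt , Pts) Pus = Pt , AllVF-++ ts us Pts Pus

  AllVF-++⁻ : (ts us : List (LTree h)) → AllVF P (ts ++ us) → AllVF P ts × AllVF P us
  AllVF-++⁻ []       us Pus          = tt , Pus
  AllVF-++⁻ (t ∷ ts) us (Pt , Ptsus) = let Pts , Pus = AllVF-++⁻ ts us Ptsus in (Pt , Pts) , Pus

  AllVF-interleaving : ∀ {ts us vs : List (LTree h)} → Interleaving ts us vs → AllVF P vs → AllVF P ts × AllVF P us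
  AllVF-interleaving []         _          = tt , tt
  AllVF-interleaving (consˡ sp) (Pv , Pvs) = let Pts , Pus = AllVF-interleaving sp Pvs in (Pv , Pts) , Pus
  AllVF-interleaving (consʳ sp) (Pv , Pvs) = let Pts , Pus = AllVF-interleaving sp Pvs in Pts , (Pv , Pus)

infix 4 _≃_
record _≃_ (ts us : List (LTree h)) : Set where
  constructor same-counts
  field count-≡ : ∀ i → cntF i ts ≡ cntF i us
open _≃_

≃-setoid : ℕ → Setoid 0ℓ 0ℓ
≃-setoid h = record
  { Carrier       = List (LTree h)
  ; _≈_           = _≃_
  ; isEquivalence = record
    { refl  = same-counts λ _ → refl
    ; sym   = λ eq → same-counts λ i → sym (count-≡ eq i)
    ; trans = λ eq eq′ → same-counts λ i → trans (count-≡ eq i) (count-≡ eq′ i)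
    }
  }

module ≃-Reasoning {h : ℕ} = SetoidReasoning (≃-setoid h)

≃-refl : {ts : List (LTree h)} → ts ≃ ts
≃-refl = Setoid.refl (≃-setoid _)

≃-trans : {ts us vs : List (LTree h)} → ts ≃ us → us ≃ vs → ts ≃ vs
≃-trans = Setoid.trans (≃-setoid _)

≃-sym : {ts us : List (LTree h)} → ts ≃ us → us ≃ ts
≃-sym = Setoid.sym (≃-setoid _)

≃⇒leavesF : {ts us : List (LTree h)} → ts ≃ us → leavesF ts ≡ leavesF us
≃⇒leavesF {ts = ts} {us} eq = trans (sym (cntF-zero ts)) (trans (count-≡ eq 0) (cntF-zero us))

++-cong-≃ : {ts ts′ us us′ : List (LTree h)} → ts ≃ ts′ → us ≃ us′ → ts ++ us ≃ ts′ ++ us′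
++-cong-≃ {ts = ts} {ts′} {us} {us′} eq eq′ = same-counts λ i → begin
  cntF i (ts ++ us)        ≡⟨ cntF-++ i ts us ⟩
  cntF i ts + cntF i us    ≡⟨ cong₂ _+_ (count-≡ eq i) (count-≡ eq′ i) ⟩
  cntF i ts′ + cntF i us′  ≡⟨ cntF-++ i ts′ us′ ⟨
  cntF i (ts′ ++ us′)      ∎
  where open ≡-Reasoning

++-comm-≃ : (ts us : List (LTree h)) → ts ++ us ≃ us ++ ts
++-comm-≃ ts us = same-counts λ i → begin
  cntF i (ts ++ us)      ≡⟨ cntF-++ i ts us ⟩
  cntF i ts + cntF i us  ≡⟨ +-comm (cntF i ts) _ ⟩
  cntF i us + cntF i ts  ≡⟨ cntF-++ i us ts ⟨
  cntF i (us ++ ts)      ∎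
  where open ≡-Reasoning

interleaving-≃ : {ts us vs : List (LTree h)} → Interleaving ts us vs → ts ++ us ≃ vs
interleaving-≃ [] = ≃-refl
interleaving-≃ {ts = t ∷ _} (consˡ sp) = ++-cong-≃ {ts = t ∷ []} ≃-refl (interleaving-≃ sp)
interleaving-≃ {ts = ts} {u ∷ us} {u ∷ vs} (consʳ sp) = begin
  ts ++ u ∷ us  ≈⟨ ++-comm-≃ ts (u ∷ us) ⟩
  u ∷ us ++ ts  ≈⟨ ++-cong-≃ {ts = u ∷ []} ≃-refl (++-comm-≃ us ts) ⟩
  u ∷ ts ++ us  ≈⟨ ++-cong-≃ {ts = u ∷ []} ≃-refl (interleaving-≃ sp) ⟩
  u ∷ vs        ∎
  where open ≃-Reasoning

interleaving-leavesF : {ts us vs : List (LTree h)} → Interleaving ts us vs → leavesF ts + leavesF us ≡ leavesF vs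
interleaving-leavesF {ts = ts} {us} sp = trans (sym (leavesF-++ ts us)) (≃⇒leavesF (interleaving-≃ sp))

rightOnly : {ts : List (LTree h)} → Interleaving [] ts ts
rightOnly = right (≡⇒Pointwise-≡ refl)

node-pair-≃ : {t t′ s s′ : LTree h} {ts ts′ ss ss′ : List (LTree h)} →
  (t ∷ ts) ++ (s ∷ ss) ≃ (t′ ∷ ts′) ++ (s′ ∷ ss′) →
  node t ts ∷ node s ss ∷ [] ≃ node t′ ts′ ∷ node s′ ss′ ∷ []
node-pair-≃ {h} {t} {t′} {s} {s′} {ts} {ts′} {ss} {ss′} eq = same-counts λ i →
  let open ≡-Reasoning
      δ = indicator i (suc h)
  in begin
  cnt i (node t ts) + (cnt i (node s ss) + 0)
    ≡⟨ cong₂ _+_ (cnt-node i t ts) (cong (_+ 0) (cnt-node i s ss)) ⟩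
  (δ + cntF i (t ∷ ts)) + ((δ + cntF i (s ∷ ss)) + 0)
    ≡⟨ shuffle δ (cntF i (t ∷ ts)) (cntF i (s ∷ ss)) ⟩
  (δ + δ) + (cntF i (t ∷ ts) + cntF i (s ∷ ss))
    ≡⟨ cong ((δ + δ) +_) (cntF-++ i (t ∷ ts) (s ∷ ss)) ⟨
  (δ + δ) + cntF i ((t ∷ ts) ++ (s ∷ ss))
    ≡⟨ cong ((δ + δ) +_) (count-≡ eq i) ⟩
  (δ + δ) + cntF i ((t′ ∷ ts′) ++ (s′ ∷ ss′))
    ≡⟨ cong ((δ + δ) +_) (cntF-++ i (t′ ∷ ts′) (s′ ∷ ss′)) ⟩
  (δ + δ) + (cntF i (t′ ∷ ts′) + cntF i (s′ ∷ ss′))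
    ≡⟨ shuffle δ (cntF i (t′ ∷ ts′)) (cntF i (s′ ∷ ss′)) ⟨
  (δ + cntF i (t′ ∷ ts′)) + ((δ + cntF i (s′ ∷ ss′)) + 0)
    ≡⟨ cong₂ _+_ (cnt-node i t′ ts′) (cong (_+ 0) (cnt-node i s′ ss′)) ⟨
  cnt i (node t′ ts′) + (cnt i (node s′ ss′) + 0)
    ∎
  where
  shuffle : ∀ d a b → (d + a) + ((d + b) + 0) ≡ (d + d) + (a + b)
  shuffle = solve-∀

UnbranchedAbove : ℕ → LTree h → Set
UnbranchedAbove {h} j t = ∀ i → j < i → i ≤ h → cnt i t ≡ 1

stem : j <′ h → List⁺ (LTree j) → LTree h
stem ≤′-refl     (t ∷ ts) = node t ts
stem (≤′-step p) ts       = node (stem p ts) []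

module _ {j : ℕ} where
  cnt-stem-≤ : ∀ {h i} (p : j <′ h) (ts : List⁺ (LTree j)) → i ≤ j → cnt i (stem p ts) ≡ cntF i (toList ts)
  cnt-stem-≤ ≤′-refl     (t ∷ ts) i≤j = cnt-node-below t ts i≤j
  cnt-stem-≤ (≤′-step p) ts       i≤j =
    trans (cnt-node-[] (stem p ts) (<⇒≤ (≤-trans (s≤s i≤j) (≤′⇒≤ p)))) (cnt-stem-≤ p ts i≤j)

  stem-unbranched : ∀ {h} (p : j <′ h) (ts : List⁺ (LTree j)) → UnbranchedAbove j (stem p ts)
  stem-unbranched p ts i j<i i≤h with m≤n⇒m<n∨m≡n i≤h
  ... | inj₂ refl = cnt-top (stem p ts)
  stem-unbranched ≤′-refl     ts i j<i i≤h | inj₁ i<h = contradiction (m<1+n⇒m≤n i<h) (<⇒≱ j<i)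
  stem-unbranched (≤′-step p) ts i j<i i≤h | inj₁ i<h =
    trans (cnt-node-[] (stem p ts) (m<1+n⇒m≤n i<h)) (stem-unbranched p ts i j<i (m<1+n⇒m≤n i<h))

  leaves-stem : ∀ {h} (p : j <′ h) (ts : List⁺ (LTree j)) → leaves (stem p ts) ≡ leavesF (toList ts)
  leaves-stem ≤′-refl     (t ∷ ts) = refl
  leaves-stem (≤′-step p) ts       = trans (+-identityʳ _) (leaves-stem p ts)

  stem-view : ∀ {h} (p : j <′ h) (t : LTree h) → UnbranchedAbove j t → Σ (List⁺ (LTree j)) λ ts → t ≡ stem p ts
  stem-view ≤′-refl (node t ts) _ = t ∷ ts , refl
  stem-view (≤′-step p) (node t []) unbranched =
    let ts , t≡stem = stem-view p t λ i j<i i≤h →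
                        trans (sym (cnt-node-[] t i≤h)) (unbranched i j<i (m≤n⇒m≤1+n i≤h))
    in ts , cong (λ s → node s []) t≡stem
  stem-view {suc h} (≤′-step p) (node t (s ∷ ss)) unbranched =
    contradiction (unbranched h (≤′⇒≤ p) (n≤1+n h)) (>⇒≢ 1<cnt)
    where
    1<cnt : 1 < cnt h (node t (s ∷ ss))
    1<cnt = subst (1 <_) (sym (cnt-node-below t (s ∷ ss) ≤-refl))
                  (≤-trans (s≤s (s≤s z≤n)) (length≤cntF (t ∷ s ∷ ss) ≤-refl))

module _ {P : ℕ → ℕ → Set} {j : ℕ} where
  AllV-stem⁻ : ∀ {h} (p : j <′ h) (ts : List⁺ (LTree j)) → AllV P (stem p ts) →
    AllVF P (toList ts) × (∀ i → j < i → i ≤ h → P i (leavesF (toList ts)))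
  AllV-stem⁻ ≤′-refl (t ∷ ts) (Pr , Pt , Pts) =
    (Pt , Pts) , λ i j<i i≤h → subst (λ i → P i _) (≤-antisym j<i i≤h) Pr
  AllV-stem⁻ {suc h} (≤′-step p) ts (Pr , Pstem , _) =
    let Pts , chain = AllV-stem⁻ p ts Pstem in Pts , chain′ chain
    where
    chain′ : (∀ i → j < i → i ≤ h → P i (leavesF (toList ts))) →
             ∀ i → j < i → i ≤ suc h → P i (leavesF (toList ts))
    chain′ chain i j<i i≤h with m≤n⇒m<n∨m≡n i≤h
    ... | inj₂ refl = subst (P i) (trans (+-identityʳ _) (leaves-stem p ts)) Pr
    ... | inj₁ i<h  = chain i j<i (m<1+n⇒m≤n i<h)

  AllV-stem⁺ : ∀ {h} (p : j <′ h) (ts : List⁺ (LTree j)) →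
    AllVF P (toList ts) → (∀ i → j < i → i ≤ h → P i (leavesF (toList ts))) → AllV P (stem p ts)
  AllV-stem⁺ ≤′-refl (t ∷ ts) Pts chain = chain (suc j) ≤-refl ≤-refl , Pts
  AllV-stem⁺ {suc h} (≤′-step p) ts Pts chain =
    subst (P (suc h)) (sym (trans (+-identityʳ _) (leaves-stem p ts))) (chain (suc h) (m≤n⇒m≤1+n (≤′⇒≤ p)) ≤-refl) ,
    AllV-stem⁺ p ts Pts (λ i j<i i≤h → chain i j<i (m≤n⇒m≤1+n i≤h)) ,
    tt

  AllV-unbranched⁻ : (t : LTree h) → UnbranchedAbove j t → AllV P t → ∀ i → j < i → i ≤ h → P i (leaves t)
  AllV-unbranched⁻ t unbranched Pt i j<i i≤h with ≤⇒≤′ (<-≤-trans j<i i≤h)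
  ... | p with stem-view p t unbranched
  ...   | ts , refl = subst (P i) (sym (leaves-stem p ts)) (proj₂ (AllV-stem⁻ p ts Pt) i j<i i≤h)

module _ {P Q : ℕ → ℕ → Set} {j : ℕ} where
  AllV-unbranched⁺ : (t : LTree h) → UnbranchedAbove j t → AllV P t →
    (∀ {i w} → i ≤ j → P i w → Q i w) → (∀ i → j < i → i ≤ h → Q i (leaves t)) → AllV Q t
  AllV-unbranched⁺ {h} t unbranched Pt widen chain with j <? h
  ... | no j≮h = AllV-map (λ i≤h → widen (≤-trans i≤h (≮⇒≥ j≮h))) t Pt
  ... | yes j<h with ≤⇒≤′ j<h
  ...   | p with stem-view p t unbranched
  ...     | ts , refl =
    AllV-stem⁺ p ts (AllVF-map widen (toList ts) (proj₁ (AllV-stem⁻ p ts Pt)))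
                    (λ i j<i i≤h → subst (Q i) (leaves-stem p ts) (chain i j<i i≤h))

module Balance (W : ℕ) (1<W : 1 < W) (P : ℕ → ℕ → Set)
  (P-convex : ∀ {i a b w} → P i a → P i b → a ≤ w → w ≤ b → P i w) where

  Small Large Light Heavy Balanced : ℕ → Set
  Small    w = 3 * w < W
  Large    w = W ≤ 3 * w
  Light    w = 3 * w ≤ 2 * W
  Heavy    w = 2 * W < 3 * w
  Balanced w = Large w × Light w

  leaf-not-heavy : ¬ Heavy 1
  leaf-not-heavy heavy = <⇒≱ heavy (≤-trans (n≤1+n 3) (*-monoʳ-≤ 2 1<W))

  heavy⇒large : ∀ w → Heavy w → Large w
  heavy⇒large w heavy = ≤-trans (m≤m+n _ _) (<⇒≤ heavy)

  small+¬light⇒large : ∀ s w → Small s → ¬ Light (s + w) → Large w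
  small+¬light⇒large s w small ¬light = <⇒≤ (+-cancelˡ-< W W (3 * w) (begin-strict
    W + W          ≡⟨ cong (W +_) (+-identityʳ W) ⟨
    2 * W          <⟨ ≰⇒> ¬light ⟩
    3 * (s + w)    ≡⟨ *-distribˡ-+ 3 s w ⟩
    3 * s + 3 * w  ≤⟨ +-monoˡ-≤ (3 * w) (<⇒≤ small) ⟩
    W + 3 * w      ∎))
    where open ≤-Reasoning

  complement-small : ∀ a b → a + b ≡ W → Heavy a → Small b
  complement-small a b sum heavy = +-cancelˡ-< (2 * W) (3 * b) W (begin-strict
    2 * W + 3 * b  <⟨ +-monoˡ-< (3 * b) heavy ⟩
    3 * a + 3 * b  ≡⟨ *-distribˡ-+ 3 a b ⟨
    3 * (a + b)    ≡⟨ cong (3 *_) sum ⟩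
    3 * W          ≡⟨ +-comm W (2 * W) ⟩
    2 * W + W      ∎)
    where open ≤-Reasoning

  complement-large : ∀ a b → a + b ≡ W → Light a → Large b
  complement-large a b sum light = +-cancelˡ-≤ (2 * W) W (3 * b) (begin
    2 * W + W      ≡⟨ +-comm (2 * W) W ⟩
    3 * W          ≡⟨ cong (3 *_) sum ⟨
    3 * (a + b)    ≡⟨ *-distribˡ-+ 3 a b ⟩
    3 * a + 3 * b  ≤⟨ +-monoˡ-≤ (3 * b) light ⟩
    2 * W + 3 * b  ∎)
    where open ≤-Reasoning

  -- a′ and b′ both lie between b and a.
  convex-pair : ∀ {i a b a′ b′} → a′ + b′ ≡ a + b → Heavy a → Small b → Balanced a′ →
    P i a → P i b → P i a′ × P i b′
  convex-pair {a = a} {b} {a′} {b′} sum heavy small (large , light) Pa Pb =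
    P-convex Pb Pa b≤a′ a′≤a , P-convex Pb Pa b≤b′ b′≤a
    where
    open ≤-Reasoning
    b≤a′ : b ≤ a′
    b≤a′ = <⇒≤ (*-cancelˡ-< 3 b a′ (<-≤-trans small large))
    a′≤a : a′ ≤ a
    a′≤a = <⇒≤ (*-cancelˡ-< 3 a′ a (≤-<-trans light heavy))
    b≤b′ : b ≤ b′
    b≤b′ = +-cancelˡ-≤ a′ b b′ (begin a′ + b ≤⟨ +-monoˡ-≤ b a′≤a ⟩ a + b ≡⟨ sum ⟨ a′ + b′ ∎)
    b′≤a : b′ ≤ a
    b′≤a = +-cancelˡ-≤ a′ b′ a
             (begin a′ + b′ ≡⟨ sum ⟩ a + b ≤⟨ +-monoʳ-≤ a b≤a′ ⟩ a + a′ ≡⟨ +-comm a a′ ⟩ a′ + a ∎)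

  search : (ts : List (LTree h)) →
    (∃₂ λ t us → Interleaving (t ∷ []) us ts × Heavy (leaves t)) ⊎ All (λ t → Light (leaves t)) ts
  search []       = inj₂ []
  search (t ∷ ts) with 3 * leaves t ≤? 2 * W | search ts
  ... | no  ¬light | _                          = inj₁ (t , ts , consˡ rightOnly , ≰⇒> ¬light)
  ... | yes light  | inj₁ (u , us , sp , heavy) = inj₁ (u , t ∷ us , consʳ sp , heavy)
  ... | yes light  | inj₂ lights                = inj₂ (light ∷ lights)

  -- s is the weight collected so far; if adding a light tree t overshoots 2W/3, then t alone is balanced.
  greedy : (ts : List (LTree h)) (s : ℕ) → Small s → Large (s + leavesF ts) → All (λ t → Light (leaves t)) ts →
    Σ (List⁺ (LTree h)) λ us → ∃ λ vs → Interleaving (toList us) vs ts ×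
      (Balanced (s + leavesF (toList us)) ⊎ Balanced (leavesF (toList us)))
  greedy [] s small large _ = contradiction (subst Large (+-identityʳ s) large) (<⇒≱ small)
  greedy (t ∷ ts) s small large (light ∷ lights) with W ≤? 3 * (s + leaves t) | 3 * (s + leaves t) ≤? 2 * W
  ... | yes large′ | yes light′ =
    t ∷ [] , ts , consˡ rightOnly , inj₁ (subst Balanced (cong (s +_) (sym (+-identityʳ (leaves t)))) (large′ , light′))
  ... | yes _      | no ¬light′ =
    t ∷ [] , ts , consˡ rightOnly ,
    inj₂ (subst Balanced (sym (+-identityʳ (leaves t))) (small+¬light⇒large s (leaves t) small ¬light′ , light))
  ... | no ¬large′ | _
    with greedy ts (s + leaves t) (≰⇒> ¬large′) (subst Large (sym (+-assoc s (leaves t) _)) large) lights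
  ...   | us , vs , sp , inj₁ bal = t ∷ toList us , vs , consˡ sp , inj₁ (subst Balanced (+-assoc s (leaves t) _) bal)
  ...   | us , vs , sp , inj₂ bal = us , t ∷ vs , consʳ sp , inj₂ bal

  record Rebalancing (ts : List (LTree h)) (y : LTree h) : Set where
    field
      group    : List⁺ (LTree h)
      y′       : LTree h
      rest     : List (LTree h)
      counts   : toList group ++ y′ ∷ rest ≃ ts ++ y ∷ []
      P-group  : AllVF P (toList group)
      P-y′     : AllV P y′
      P-rest   : AllVF P rest
      balanced : Balanced (leavesF (toList group))

  -- If ts contains a heavy tree z, the children of z are rebalanced against the first child of y one
  -- layer down, and the results are hung below two new roots x′ and y″.
  rebalance : ∀ h (ts : List (LTree h)) (y : LTree h) → Heavy (leavesF ts) → Small (leaves y) →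
    AllVF P ts → AllV P y → Rebalancing ts y
  rebalance h ts y heavy small Pts Py with search ts
  ... | inj₂ lights with greedy ts 0 (≤-trans (s≤s z≤n) 1<W) (heavy⇒large (leavesF ts) heavy) lights
  ...   | us , vs , sp , bal =
    let Pus , Pvs = AllVF-interleaving sp Pts
    in record { group = us ; y′ = y ; rest = vs ; counts = counts
              ; P-group = Pus ; P-y′ = Py ; P-rest = Pvs ; balanced = reduce bal }
    where
    counts : toList us ++ y ∷ vs ≃ ts ++ y ∷ []
    counts = begin
      toList us ++ y ∷ vs          ≈⟨ ++-cong-≃ {ts = toList us} ≃-refl (++-comm-≃ (y ∷ []) vs) ⟩
      toList us ++ vs ++ y ∷ []    ≡⟨ ++-assoc (toList us) vs (y ∷ []) ⟨
      (toList us ++ vs) ++ y ∷ []  ≈⟨ ++-cong-≃ (interleaving-≃ sp) ≃-refl ⟩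
      ts ++ y ∷ []                 ∎
      where open ≃-Reasoning
  rebalance zero ts leaf _ _ _ _ | inj₁ (leaf , _ , _ , heavy-leaf) = contradiction heavy-leaf leaf-not-heavy
  rebalance (suc h) ts y@(node y₀ ys) heavy small Pts (Py , Py₀ , Pys) | inj₁ (z@(node z₀ zs) , us , sp , heavy-z) =
    record { group = x′ ∷ [] ; y′ = y″ ; rest = us ; counts = counts
           ; P-group = (proj₁ roots , R.P-group) , tt
           ; P-y′ = proj₂ roots , R.P-y′ , AllVF-++ R.rest ys R.P-rest Pys
           ; P-rest = Pus ; balanced = subst Balanced (sym (+-identityʳ (leaves x′))) R.balanced }
    where
    Pz-us : AllVF P (z ∷ []) × AllVF P us
    Pz-us = AllVF-interleaving sp Pts
    Pz : AllV P z
    Pz = proj₁ (proj₁ Pz-us)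
    Pus : AllVF P us
    Pus = proj₂ Pz-us
    small₀ : Small (leaves y₀)
    small₀ = ≤-<-trans (*-monoʳ-≤ 3 (m≤m+n (leaves y₀) (leavesF ys))) small
    module R = Rebalancing (rebalance h (z₀ ∷ zs) y₀ heavy-z small₀ (proj₂ Pz) Py₀)
    x′ y″ : LTree (suc h)
    x′ = node (head R.group) (tail R.group)
    y″ = node R.y′ (R.rest ++ ys)
    children : toList R.group ++ R.y′ ∷ R.rest ++ ys ≃ (z₀ ∷ zs) ++ y₀ ∷ ys
    children = begin
      toList R.group ++ R.y′ ∷ R.rest ++ ys    ≡⟨ ++-assoc (toList R.group) (R.y′ ∷ R.rest) ys ⟨
      (toList R.group ++ R.y′ ∷ R.rest) ++ ys  ≈⟨ ++-cong-≃ R.counts ≃-refl ⟩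
      ((z₀ ∷ zs) ++ y₀ ∷ []) ++ ys             ≡⟨ ++-assoc (z₀ ∷ zs) (y₀ ∷ []) ys ⟩
      (z₀ ∷ zs) ++ y₀ ∷ ys                     ∎
      where open ≃-Reasoning
    counts : x′ ∷ y″ ∷ us ≃ ts ++ y ∷ []
    counts = begin
      x′ ∷ y″ ∷ us      ≈⟨ ++-cong-≃ (node-pair-≃ children) ≃-refl ⟩
      z ∷ y ∷ us        ≈⟨ ++-cong-≃ {ts = z ∷ []} ≃-refl (++-comm-≃ (y ∷ []) us) ⟩
      z ∷ us ++ y ∷ []  ≈⟨ ++-cong-≃ (interleaving-≃ sp) ≃-refl ⟩
      ts ++ y ∷ []      ∎
      where open ≃-Reasoning
    sum : leaves x′ + leaves y″ ≡ leaves z + leaves y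
    sum = begin
      leavesF (toList R.group) + (leaves R.y′ + leavesF (R.rest ++ ys))  ≡⟨ leavesF-++ (toList R.group) _ ⟨
      leavesF (toList R.group ++ R.y′ ∷ R.rest ++ ys)                    ≡⟨ ≃⇒leavesF children ⟩
      leavesF ((z₀ ∷ zs) ++ y₀ ∷ ys)                                     ≡⟨ leavesF-++ (z₀ ∷ zs) _ ⟩
      leavesF (z₀ ∷ zs) + (leaves y₀ + leavesF ys)                       ∎
      where open ≡-Reasoning
    roots : P (suc h) (leaves x′) × P (suc h) (leaves y″)
    roots = convex-pair sum heavy-z small R.balanced (proj₁ Pz) Py

  record Partition (ts : List (LTree h)) : Set where
    field
      part₁ part₂ : List⁺ (LTree h)
      counts      : toList part₁ ++ toList part₂ ≃ ts
      P-part₁     : AllVF P (toList part₁)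
      P-part₂     : AllVF P (toList part₂)
      large₁      : Large (leavesF (toList part₁))
      large₂      : Large (leavesF (toList part₂))

  rest-large : ∀ {us vs ts : List (LTree h)} → Interleaving us vs ts → leavesF ts ≡ W →
    Light (leavesF us) → Large (leavesF vs)
  rest-large {us = us} {vs} sp total = complement-large (leavesF us) (leavesF vs) (trans (interleaving-leavesF sp) total)

  partition : (ts : List (LTree h)) → leavesF ts ≡ W → 1 < cntF h ts → AllVF P ts → Partition ts
  partition ts total several Pts with search ts
  ... | inj₂ lights with greedy ts 0 (≤-trans (s≤s z≤n) 1<W) (subst Large (sym total) (m≤m+n W _)) lights
  ...   | us , [] , sp , bal = contradiction (≤-trans (rest-large sp total (proj₂ (reduce bal))) z≤n) (<⇒≱ 1<W)
  ...   | us , v ∷ vs , sp , bal =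
    let Pus , Pvs = AllVF-interleaving sp Pts
    in record { part₁ = us ; part₂ = v ∷ vs ; counts = interleaving-≃ sp ; P-part₁ = Pus ; P-part₂ = Pvs
              ; large₁ = proj₁ (reduce bal) ; large₂ = rest-large sp total (proj₂ (reduce bal)) }
  partition {h} ts total several Pts | inj₁ (v , [] , sp , _) =
    contradiction (trans (sym (count-≡ (interleaving-≃ sp) h)) (trans (+-identityʳ _) (cnt-top v))) (>⇒≢ several)
  partition {h} ts total several Pts | inj₁ (v , y ∷ us , sp , heavy) =
    record { part₁ = R.group ; part₂ = R.y′ ∷ R.rest ++ us ; counts = counts
           ; P-part₁ = R.P-group ; P-part₂ = R.P-y′ , AllVF-++ R.rest us R.P-rest Pus
           ; large₁ = proj₁ R.balanced ; large₂ = complement-large (leavesF (toList R.group)) _ sum (proj₂ R.balanced) }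
    where
    Pv-y-us : AllVF P (v ∷ []) × AllVF P (y ∷ us)
    Pv-y-us = AllVF-interleaving sp Pts
    Pv : AllVF P (v ∷ [])
    Pv = proj₁ Pv-y-us
    Py : AllV P y
    Py = proj₁ (proj₂ Pv-y-us)
    Pus : AllVF P us
    Pus = proj₂ (proj₂ Pv-y-us)
    heavy′ : Heavy (leaves v + 0)
    heavy′ = subst Heavy (sym (+-identityʳ (leaves v))) heavy
    small : Small (leaves y)
    small = ≤-<-trans (*-monoʳ-≤ 3 (m≤m+n (leaves y) (leavesF us)))
                      (complement-small (leaves v + 0) (leavesF (y ∷ us)) (trans (interleaving-leavesF sp) total) heavy′)
    module R = Rebalancing (rebalance h (v ∷ []) y heavy′ small Pv Py)
    counts : toList R.group ++ R.y′ ∷ R.rest ++ us ≃ ts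
    counts = begin
      toList R.group ++ R.y′ ∷ R.rest ++ us    ≡⟨ ++-assoc (toList R.group) (R.y′ ∷ R.rest) us ⟨
      (toList R.group ++ R.y′ ∷ R.rest) ++ us  ≈⟨ ++-cong-≃ R.counts ≃-refl ⟩
      v ∷ y ∷ us                               ≈⟨ interleaving-≃ sp ⟩
      ts                                       ∎
      where open ≃-Reasoning
    sum : leavesF (toList R.group) + leavesF (R.y′ ∷ R.rest ++ us) ≡ W
    sum = trans (sym (leavesF-++ (toList R.group) _)) (trans (≃⇒leavesF counts) total)

module _ {m : ℕ} where
  ∀Fin⇒∀≤ : (P : ℕ → Set) → (∀ (i : Fin (suc m)) → P (toℕ i)) → ∀ i → i ≤ m → P i
  ∀Fin⇒∀≤ P f i i≤m = subst P (toℕ-fromℕ< (s≤s i≤m)) (f (fromℕ< (s≤s i≤m)))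

  lookup-combination-≤ : ∀ {k i : Fin (suc m)} (a b : Vec ℕ (suc m)) → toℕ i ≤ toℕ k →
    lookup (combination k a b) i ≡ lookup a i + lookup b i
  lookup-combination-≤ {k} {i} a b i≤k
    with toℕ i ≤ᵇ toℕ k | ≤⇒≤ᵇ i≤k
       | lookup∘tabulate (λ j → if toℕ j ≤ᵇ toℕ k then lookup a j + lookup b j else 1) i
  ... | true | _ | eq = eq

  lookup-combination-> : ∀ {k i : Fin (suc m)} (a b : Vec ℕ (suc m)) → toℕ k < toℕ i →
    lookup (combination k a b) i ≡ 1
  lookup-combination-> {k} {i} a b k<i
    with toℕ i ≤ᵇ toℕ k in i≤ᵇk
       | lookup∘tabulate (λ j → if toℕ j ≤ᵇ toℕ k then lookup a j + lookup b j else 1) i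
  ... | false | eq = eq
  ... | true  | _  = contradiction (≤ᵇ⇒≤ (toℕ i) (toℕ k) (subst T (sym i≤ᵇk) tt)) (<⇒≱ k<i)

  combination-monoˡ-≤ : ∀ (k : Fin (suc m)) (a′ a b : Vec ℕ (suc m)) →
    (∀ i → lookup a′ i ≤ lookup a i) → ∀ i → lookup (combination k a′ b) i ≤ lookup (combination k a b) i
  combination-monoˡ-≤ k a′ a b a′≤a i with toℕ i ≤? toℕ k
  ... | yes i≤k = begin
    lookup (combination k a′ b) i  ≡⟨ lookup-combination-≤ a′ b i≤k ⟩
    lookup a′ i + lookup b i       ≤⟨ +-monoˡ-≤ (lookup b i) (a′≤a i) ⟩
    lookup a i + lookup b i        ≡⟨ lookup-combination-≤ a b i≤k ⟨
    lookup (combination k a b) i   ∎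
    where open ≤-Reasoning
  ... | no i≰k =
    ≤-reflexive (trans (lookup-combination-> a′ b (≰⇒> i≰k)) (sym (lookup-combination-> a b (≰⇒> i≰k))))

  combination-injectiveˡ : ∀ (k : Fin (suc m)) (a′ a b : Vec ℕ (suc m)) →
    (∀ i → k F.< i → lookup a′ i ≡ lookup a i) → combination k a′ b ≡ combination k a b → a′ ≡ a
  combination-injectiveˡ k a′ a b above eq = Pointwise-≡⇒≡ (ext pointwise)
    where
    pointwise : ∀ i → lookup a′ i ≡ lookup a i
    pointwise i with toℕ i ≤? toℕ k
    ... | no i≰k  = above i (≰⇒> i≰k)
    ... | yes i≤k = +-cancelʳ-≡ (lookup b i) _ _ (begin
      lookup a′ i + lookup b i       ≡⟨ lookup-combination-≤ a′ b i≤k ⟨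
      lookup (combination k a′ b) i  ≡⟨ cong (λ v → lookup v i) eq ⟩
      lookup (combination k a b) i   ≡⟨ lookup-combination-≤ a b i≤k ⟩
      lookup a i + lookup b i        ∎)
      where open ≡-Reasoning

  branching-≤ : ∀ (v : Vec ℕ (suc m)) {k} j → Branching v k → (∀ i → j < toℕ i → lookup v i ≤ 1) → toℕ k ≤ j
  branching-≤ v {k} j (_ , at-k) flat with toℕ k ≤? j
  ... | yes k≤j = k≤j
  ... | no  k≰j with at-k
  ...   | inj₁ k≡0  = contradiction k≡0 (>⇒≢ (≤-trans (s≤s z≤n) (≰⇒> k≰j)))
  ...   | inj₂ 1<vₖ = contradiction (flat k (≰⇒> k≰j)) (<⇒≱ 1<vₖ)

  branching-unique : ∀ (v : Vec ℕ (suc m)) {k k′} → Branching v k → Branching v k′ → k ≡ k′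
  branching-unique v {k} {k′} br br′ =
    toℕ-injective (≤-antisym (branching-≤ v (toℕ k′) br (proj₁ br′)) (branching-≤ v (toℕ k) br′ (proj₁ br)))

  branching-exists : ∀ (v : Vec ℕ (suc m)) j → j ≤ m → (∀ i → j < toℕ i → lookup v i ≤ 1) →
    Σ (Fin (suc m)) λ k → Branching v k × toℕ k ≤ j
  branching-exists v zero    _   flat = F.zero , (flat , inj₁ refl) , z≤n
  branching-exists v (suc j) j<m flat with 1 <? lookup v (fromℕ< (s≤s j<m))
  ... | yes 1<vⱼ = fromℕ< (s≤s j<m) , (flat′ , inj₂ 1<vⱼ) , ≤-reflexive (toℕ-fromℕ< (s≤s j<m))
    where
    flat′ : ∀ i → toℕ (fromℕ< (s≤s j<m)) < toℕ i → lookup v i ≤ 1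
    flat′ i = flat i ∘ subst (_< toℕ i) (toℕ-fromℕ< (s≤s j<m))
  ... | no  1≮vⱼ =
    let k , br , k≤j = branching-exists v j (<⇒≤ j<m) flat′ in k , br , m≤n⇒m≤1+n k≤j
    where
    flat′ : ∀ i → j < toℕ i → lookup v i ≤ 1
    flat′ i j<i with toℕ i ≟ suc j
    ... | no  i≢1+j = flat i (≤∧≢⇒< j<i (i≢1+j ∘ sym))
    ... | yes i≡1+j = subst (λ l → lookup v l ≤ 1) (toℕ-injective (trans (toℕ-fromℕ< (s≤s j<m)) (sym i≡1+j)))
                            (≮⇒≥ 1≮vⱼ)

  branching-count : ∀ (v : Vec ℕ (suc m)) {k} → Branching v k → 1 < lookup v F.zero → 1 < lookup v k
  branching-count v (_ , inj₂ 1<vₖ) _    = 1<vₖ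
  branching-count v (_ , inj₁ k≡0)  1<v₀ = subst (λ l → 1 < lookup v l) (toℕ-injective (sym k≡0)) 1<v₀

module _ {m : ℕ} where
  lookup-profile : (t : LTree m) (i : Fin (suc m)) → lookup (profile t) i ≡ cnt (toℕ i) t
  lookup-profile t = lookup∘tabulate (λ i → cnt (toℕ i) t)

  profile≤1⇒unbranched : ∀ {j} (t : LTree m) → (∀ i → j < toℕ i → lookup (profile t) i ≤ 1) → UnbranchedAbove j t
  profile≤1⇒unbranched {j} t flat i j<i i≤m = ≤-antisym cnt≤1 (cnt-positive t i≤m)
    where
    cnt≤1 : cnt i t ≤ 1
    cnt≤1 = ∀Fin⇒∀≤ (λ i → j < i → cnt i t ≤ 1)
                    (λ l j<l → subst (_≤ 1) (lookup-profile t l) (flat l j<l)) i i≤m j<i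

  unbranched⇒profile≡1 : ∀ {j} (t : LTree m) → UnbranchedAbove j t → ∀ i → j < toℕ i → lookup (profile t) i ≡ 1
  unbranched⇒profile≡1 t unbranched i j<i = trans (lookup-profile t i) (unbranched (toℕ i) j<i (toℕ≤pred[n] i))

  branching<root : (t : LTree m) {k : Fin (suc m)} → Branching (profile t) k → 1 < lookup (profile t) F.zero → toℕ k < m
  branching<root t {k} br 1<t₀ = ≤∧≢⇒< (toℕ≤pred[n] k) k≢m
    where
    k≢m : toℕ k ≢ m
    k≢m k≡m = <⇒≢ (branching-count (profile t) br 1<t₀)
                  (sym (trans (lookup-profile t k) (trans (cong (λ i → cnt i t) k≡m) (cnt-top t))))

  module _ {k : Fin (suc m)} (p : toℕ k <′ m) where
    stem-branching : (ts : List⁺ (LTree (toℕ k))) →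
      Σ (Fin (suc m)) λ kₜ → Branching (profile (stem p ts)) kₜ × toℕ kₜ ≤ toℕ k
    stem-branching ts = branching-exists (profile (stem p ts)) (toℕ k) (toℕ≤pred[n] k)
      (λ i k<i → ≤-reflexive (unbranched⇒profile≡1 (stem p ts) (stem-unbranched p ts) i k<i))

    cnt-stem-++ : ∀ {i} (ts us : List⁺ (LTree (toℕ k))) → i ≤ toℕ k →
      cnt i (stem p (ts ⁺++⁺ us)) ≡ cnt i (stem p ts) + cnt i (stem p us)
    cnt-stem-++ {i} ts us i≤k = begin
      cnt i (stem p (ts ⁺++⁺ us))               ≡⟨ cnt-stem-≤ p (ts ⁺++⁺ us) i≤k ⟩
      cntF i (toList ts ++ toList us)           ≡⟨ cntF-++ i (toList ts) (toList us) ⟩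
      cntF i (toList ts) + cntF i (toList us)   ≡⟨ cong₂ _+_ (cnt-stem-≤ p ts i≤k) (cnt-stem-≤ p us i≤k) ⟨
      cnt i (stem p ts) + cnt i (stem p us)     ∎
      where open ≡-Reasoning

    cnt-stem-++ˡ : ∀ {i} (ts us : List⁺ (LTree (toℕ k))) → i ≤ m → cnt i (stem p ts) ≤ cnt i (stem p (ts ⁺++⁺ us))
    cnt-stem-++ˡ {i} ts us i≤m with i ≤? toℕ k
    ... | yes i≤k = ≤-trans (m≤m+n _ _) (≤-reflexive (sym (cnt-stem-++ ts us i≤k)))
    ... | no  i≰k = ≤-reflexive (trans (stem-unbranched p ts i (≰⇒> i≰k) i≤m)
                                       (sym (stem-unbranched p (ts ⁺++⁺ us) i (≰⇒> i≰k) i≤m)))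

    cnt-stem-≃ : (ts us : List⁺ (LTree (toℕ k))) → toList ts ≃ toList us →
      ∀ {i} → i ≤ m → cnt i (stem p ts) ≡ cnt i (stem p us)
    cnt-stem-≃ ts us eq {i} i≤m with i ≤? toℕ k
    ... | yes i≤k = trans (cnt-stem-≤ p ts i≤k) (trans (count-≡ eq i) (sym (cnt-stem-≤ p us i≤k)))
    ... | no  i≰k = trans (stem-unbranched p ts i (≰⇒> i≰k) i≤m) (sym (stem-unbranched p us i (≰⇒> i≰k) i≤m))

    profile-stem-≃ : (ts us : List⁺ (LTree (toℕ k))) → toList ts ≃ toList us → profile (stem p ts) ≡ profile (stem p us)
    profile-stem-≃ ts us eq = tabulate-cong λ i → cnt-stem-≃ ts us eq (toℕ≤pred[n] i)

    profile-stem-++ : (ts us : List⁺ (LTree (toℕ k))) →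
      profile (stem p (ts ⁺++⁺ us)) ≡ combination k (profile (stem p ts)) (profile (stem p us))
    profile-stem-++ ts us = Pointwise-≡⇒≡ (ext pointwise)
      where
      a b : Vec ℕ (suc m)
      a = profile (stem p ts)
      b = profile (stem p us)
      pointwise : ∀ i → lookup (profile (stem p (ts ⁺++⁺ us))) i ≡ lookup (combination k a b) i
      pointwise i with toℕ i ≤? toℕ k
      ... | yes i≤k = begin
        lookup (profile (stem p (ts ⁺++⁺ us))) i
          ≡⟨ lookup-profile (stem p (ts ⁺++⁺ us)) i ⟩
        cnt (toℕ i) (stem p (ts ⁺++⁺ us))
          ≡⟨ cnt-stem-++ ts us i≤k ⟩
        cnt (toℕ i) (stem p ts) + cnt (toℕ i) (stem p us)
          ≡⟨ cong₂ _+_ (lookup-profile (stem p ts) i) (lookup-profile (stem p us) i) ⟨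
        lookup a i + lookup b i
          ≡⟨ lookup-combination-≤ a b i≤k ⟨
        lookup (combination k a b) i
          ∎
        where open ≡-Reasoning
      ... | no i≰k = trans (unbranched⇒profile≡1 (stem p (ts ⁺++⁺ us)) (stem-unbranched p (ts ⁺++⁺ us)) i (≰⇒> i≰k))
                           (sym (lookup-combination-> a b (≰⇒> i≰k)))

    profile-stem-combination : (ts us F : List⁺ (LTree (toℕ k))) → toList ts ++ toList us ≃ toList F →
      profile (stem p F) ≡ combination k (profile (stem p ts)) (profile (stem p us))
    profile-stem-combination ts us F counts = trans (profile-stem-≃ F (ts ⁺++⁺ us) (≃-sym counts)) (profile-stem-++ ts us)

    stem-++-branching : (ts us : List⁺ (LTree (toℕ k))) → Branching (profile (stem p (ts ⁺++⁺ us))) k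
    stem-++-branching ts us =
      (λ i k<i → ≤-reflexive (unbranched⇒profile≡1 (stem p (ts ⁺++⁺ us)) (stem-unbranched p (ts ⁺++⁺ us)) i k<i)) ,
      inj₂ (subst (1 <_) (sym count) (+-mono-≤ (cnt-positive (stem p ts) k≤m) (cnt-positive (stem p us) k≤m)))
      where
      k≤m : toℕ k ≤ m
      k≤m = toℕ≤pred[n] k
      count : lookup (profile (stem p (ts ⁺++⁺ us))) k ≡ cnt (toℕ k) (stem p ts) + cnt (toℕ k) (stem p us)
      count = trans (lookup-profile (stem p (ts ⁺++⁺ us)) k) (cnt-stem-++ ts us ≤-refl)

module _ (I : Instance) where
  open Instance I

  Bounded : ℕ → ℕ → ℕ → Set
  Bounded k i w = 1 ≤ i → i ≤ k → L I i ≤ w × w ≤ U I i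

  Bounded-convex : ∀ {k i a b w} → Bounded k i a → Bounded k i b → a ≤ w → w ≤ b → Bounded k i w
  Bounded-convex Ba Bb a≤w w≤b 1≤i i≤k = ≤-trans (proj₁ (Ba 1≤i i≤k)) a≤w , ≤-trans w≤b (proj₂ (Bb 1≤i i≤k))

  Bounded-above : ∀ {k w} i → k < i → Bounded k i w
  Bounded-above i k<i _ i≤k = contradiction i≤k (<⇒≱ k<i)

  -- AlmostValidWith I t k unfolds to ValidUpTo (toℕ k) t.
  ValidUpTo : ℕ → LTree layers → Set
  ValidUpTo k t =
      (∀ (i : Fin (suc layers)) → cnt (toℕ i) t ≤ n (toℕ i))
    × AllV (Bounded k) t
    × (∀ (i : Fin (suc layers)) → k < toℕ i → leaves t ≤ U I (toℕ i))

  L-mono : Normalized I → ∀ {i j} → i ≤ j → j ≤ layers → L I i ≤ L I j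
  L-mono normalized {j = zero} z≤n _ = ≤-refl
  L-mono normalized {i} {suc j} i≤1+j 1+j≤λ with m≤n⇒m<n∨m≡n i≤1+j
  ... | inj₂ refl  = ≤-refl
  ... | inj₁ i<1+j =
    ≤-trans (L-mono normalized (m<1+n⇒m≤n i<1+j) (<⇒≤ 1+j≤λ)) (proj₁ (proj₂ (normalized j 1+j≤λ)))

  ValidUpTo-lower : ∀ {j k} (t : LTree layers) → UnbranchedAbove j t → j ≤ k → ValidUpTo k t → ValidUpTo j t
  ValidUpTo-lower {j} {k} t unbranched j≤k (cap , Pt , upper) = cap , AllV-map narrow t Pt , upper′
    where
    narrow : ∀ {i w} → i ≤ layers → Bounded k i w → Bounded j i w
    narrow _ B 1≤i i≤j = B 1≤i (≤-trans i≤j j≤k)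
    upper′ : ∀ i → j < toℕ i → leaves t ≤ U I (toℕ i)
    upper′ i j<i with toℕ i ≤? k
    ... | yes i≤k =
      proj₂ (AllV-unbranched⁻ t unbranched Pt (toℕ i) j<i (toℕ≤pred[n] i) (≤-trans (s≤s z≤n) j<i) i≤k)
    ... | no  i≰k = upper i (≰⇒> i≰k)

  ValidUpTo-raise : Normalized I → ∀ {j k} (t : LTree layers) → UnbranchedAbove j t → j ≤ k → k ≤ layers →
    (1 ≤ k → L I k ≤ leaves t) → ValidUpTo j t → ValidUpTo k t
  ValidUpTo-raise normalized {j} {k} t unbranched j≤k k≤λ Lₖ≤ (cap , Pt , upper) =
    cap , AllV-unbranched⁺ t unbranched Pt widen chain , λ i k<i → upper i (≤-<-trans j≤k k<i)
    where
    widen : ∀ {i w} → i ≤ j → Bounded j i w → Bounded k i w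
    widen i≤j B 1≤i _ = B 1≤i i≤j
    chain : ∀ i → j < i → i ≤ layers → Bounded k i (leaves t)
    chain i j<i i≤λ 1≤i i≤k =
      ≤-trans (L-mono normalized i≤k k≤λ) (Lₖ≤ (≤-trans 1≤i i≤k)) ,
      ∀Fin⇒∀≤ (λ i → j < i → leaves t ≤ U I i) upper i i≤λ j<i

  ValidUpTo⇒AlmostValid : ∀ {j} (t : LTree layers) → j ≤ layers → UnbranchedAbove j t → ValidUpTo j t → AlmostValid I t
  ValidUpTo⇒AlmostValid {j} t j≤λ unbranched valid =
    let kₜ , br , kₜ≤j = branching-exists (profile t) j j≤λ
                           (λ i j<i → ≤-reflexive (unbranched⇒profile≡1 t unbranched i j<i))
    in kₜ , br , ValidUpTo-lower t (profile≤1⇒unbranched t (proj₁ br)) kₜ≤j valid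

  dominates⇒≤ : ∀ {a b} → Dominates I a b → ∀ i → lookup a i ≤ lookup b i
  dominates⇒≤ (_ , _ , _ , a₀≡b₀ , _  ) F.zero    = ≤-reflexive a₀≡b₀
  dominates⇒≤ (_ , _ , _ , _     , a≤b) (F.suc i) = a≤b (F.suc i) (s≤s z≤n)

  dominator-unbranched : ∀ {j} (t s : LTree layers) → Dominates I (profile t) (profile s) →
    UnbranchedAbove j s → UnbranchedAbove j t
  dominator-unbranched t s dom unbranched = profile≤1⇒unbranched t λ i j<i →
    ≤-trans (dominates⇒≤ dom i) (≤-reflexive (unbranched⇒profile≡1 s unbranched i j<i))

  combination-dominates : ∀ k (a′ a b : Vec ℕ (suc layers)) → Dominates I a′ a →
    (∀ i → k F.< i → lookup a′ i ≡ lookup a i) →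
    RelaxedPartialSolution I (combination k a′ b) → RelaxedPartialSolution I (combination k a b) →
    Dominates I (combination k a′ b) (combination k a b)
  combination-dominates k a′ a b dom@(_ , _ , a′≢a , a′₀≡a₀ , _) above rps′ rps =
    rps′ , rps , a′≢a ∘ combination-injectiveˡ k a′ a b above , cong (_+ lookup b F.zero) a′₀≡a₀ ,
    λ i _ → combination-monoˡ-≤ k a′ a b (dominates⇒≤ dom) i

  module _ {k : Fin (suc layers)} (p : toℕ k <′ layers) where
    bounded-stem⁺ : (ts : List⁺ (LTree (toℕ k))) → AllVF (Bounded (toℕ k)) (toList ts) →
      AllV (Bounded (toℕ k)) (stem p ts)
    bounded-stem⁺ ts Pts = AllV-stem⁺ p ts Pts (λ i k<i _ → Bounded-above i k<i)

    bounded-stem-++⁻ : (ts us : List⁺ (LTree (toℕ k))) → AllV (Bounded (toℕ k)) (stem p (ts ⁺++⁺ us)) →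
      AllVF (Bounded (toℕ k)) (toList ts) × AllVF (Bounded (toℕ k)) (toList us)
    bounded-stem-++⁻ ts us P = AllVF-++⁻ (toList ts) (toList us) (proj₁ (AllV-stem⁻ p (ts ⁺++⁺ us) P))

    stem-valid-≃ : (ts us : List⁺ (LTree (toℕ k))) → toList ts ≃ toList us → AllVF (Bounded (toℕ k)) (toList ts) →
      ValidUpTo (toℕ k) (stem p us) → ValidUpTo (toℕ k) (stem p ts)
    stem-valid-≃ ts us eq Pts (cap , _ , upper) =
      (λ i → subst (_≤ n (toℕ i)) (sym (cnt-stem-≃ p ts us eq (toℕ≤pred[n] i))) (cap i)) ,
      bounded-stem⁺ ts Pts ,
      λ i k<i → subst (_≤ U I (toℕ i)) leaves≡ (upper i k<i)
      where
      leaves≡ : leaves (stem p us) ≡ leaves (stem p ts)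
      leaves≡ = subst₂ _≡_ (cnt-zero (stem p us)) (cnt-zero (stem p ts)) (sym (cnt-stem-≃ p ts us eq z≤n))

    stem-valid-++ˡ : (ts us : List⁺ (LTree (toℕ k))) →
      ValidUpTo (toℕ k) (stem p (ts ⁺++⁺ us)) → ValidUpTo (toℕ k) (stem p ts)
    stem-valid-++ˡ ts us (cap , P , upper) =
      (λ i → ≤-trans (cnt-stem-++ˡ p ts us (toℕ≤pred[n] i)) (cap i)) ,
      bounded-stem⁺ ts (proj₁ (bounded-stem-++⁻ ts us P)) ,
      λ i k<i → ≤-trans leaves≤ (upper i k<i)
      where
      leaves≤ : leaves (stem p ts) ≤ leaves (stem p (ts ⁺++⁺ us))
      leaves≤ = subst₂ _≤_ (cnt-zero (stem p ts)) (cnt-zero (stem p (ts ⁺++⁺ us))) (cnt-stem-++ˡ p ts us z≤n)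

    graft-valid : (ts′ ts us : List⁺ (LTree (toℕ k))) →
      (∀ i → lookup (profile (stem p ts′)) i ≤ lookup (profile (stem p ts)) i) →
      ValidUpTo (toℕ k) (stem p ts′) → ValidUpTo (toℕ k) (stem p (ts ⁺++⁺ us)) →
      ValidUpTo (toℕ k) (stem p (ts′ ⁺++⁺ us))
    graft-valid ts′ ts us ts′≤ts (_ , Pts′ , _) (cap , P , upper) =
      (λ i → ≤-trans (cnt≤ i) (cap i)) ,
      bounded-stem⁺ (ts′ ⁺++⁺ us)
        (AllVF-++ (toList ts′) (toList us) (proj₁ (AllV-stem⁻ p ts′ Pts′)) (proj₂ (bounded-stem-++⁻ ts us P))) ,
      λ i k<i → ≤-trans (subst₂ _≤_ (cnt-zero grafted) (cnt-zero original) (cnt≤ F.zero)) (upper i k<i)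
      where
      grafted original : LTree layers
      grafted  = stem p (ts′ ⁺++⁺ us)
      original = stem p (ts ⁺++⁺ us)
      a′ a b : Vec ℕ (suc layers)
      a′ = profile (stem p ts′)
      a  = profile (stem p ts)
      b  = profile (stem p us)
      cnt≤ : ∀ i → cnt (toℕ i) grafted ≤ cnt (toℕ i) original
      cnt≤ i = begin
        cnt (toℕ i) grafted            ≡⟨ lookup-profile grafted i ⟨
        lookup (profile grafted) i     ≡⟨ cong (λ v → lookup v i) (profile-stem-++ p ts′ us) ⟩
        lookup (combination k a′ b) i  ≤⟨ combination-monoˡ-≤ k a′ a b ts′≤ts i ⟩
        lookup (combination k a b) i   ≡⟨ cong (λ v → lookup v i) (profile-stem-++ p ts us) ⟨
        lookup (profile original) i    ≡⟨ lookup-profile original i ⟩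
        cnt (toℕ i) original           ∎
        where open ≤-Reasoning

    -- Raising the dominator's branching layer to k is where normalization (ℓ monotone) is needed.
    dominator-stem : Normalized I → ∀ {a′} (ts : List⁺ (LTree (toℕ k))) → AllVF (Bounded (toℕ k)) (toList ts) →
      Dominates I a′ (profile (stem p ts)) →
      Σ (List⁺ (LTree (toℕ k))) λ ts′ → a′ ≡ profile (stem p ts′) × ValidUpTo (toℕ k) (stem p ts′)
    dominator-stem normalized ts Pts dom@((t′ , (k′ , br′ , valid′) , refl) , _ , _ , t′₀≡ , _)
      with stem-view p t′ (dominator-unbranched t′ (stem p ts) dom (stem-unbranched p ts))
    ... | ts′ , refl =
      ts′ , refl ,
      ValidUpTo-raise normalized (stem p ts′) (profile≤1⇒unbranched (stem p ts′) (proj₁ br′))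
                      k′≤k (toℕ≤pred[n] k) Lₖ≤ valid′
      where
      k′≤k : toℕ k′ ≤ toℕ k
      k′≤k = branching-≤ (profile (stem p ts′)) (toℕ k) br′
               (λ i k<i → ≤-reflexive (unbranched⇒profile≡1 (stem p ts′) (stem-unbranched p ts′) i k<i))
      Lₖ≤ : 1 ≤ toℕ k → L I (toℕ k) ≤ leaves (stem p ts′)
      Lₖ≤ 1≤k = begin
        L I (toℕ k)          ≤⟨ proj₁ (AllV-root (head ts) (proj₁ Pts) 1≤k ≤-refl) ⟩
        leaves (head ts)     ≤⟨ m≤m+n _ _ ⟩
        leavesF (toList ts)  ≡⟨ leaves-stem p ts ⟨
        leaves (stem p ts)   ≡⟨ cnt-zero (stem p ts) ⟨
        cnt 0 (stem p ts)    ≡⟨ t′₀≡ ⟨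
        cnt 0 (stem p ts′)   ≡⟨ cnt-zero (stem p ts′) ⟩
        leaves (stem p ts′)  ∎
        where open ≤-Reasoning

    stem-paretoOptimal : Normalized I → (ts us F : List⁺ (LTree (toℕ k))) → toList ts ++ toList us ≃ toList F →
      AllVF (Bounded (toℕ k)) (toList ts) → AllVF (Bounded (toℕ k)) (toList us) →
      ValidUpTo (toℕ k) (stem p F) → ParetoOptimal I (profile (stem p F)) → ParetoOptimal I (profile (stem p ts))
    stem-paretoOptimal normalized ts us F counts Pts Pus valid-F (rps , undominated) =
      (stem p ts ,
       ValidUpTo⇒AlmostValid (stem p ts) (toℕ≤pred[n] k) (stem-unbranched p ts) (stem-valid-++ˡ ts us valid) ,
       refl) ,
      refute
      where
      a b : Vec ℕ (suc layers)
      a = profile (stem p ts)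
      b = profile (stem p us)
      valid : ValidUpTo (toℕ k) (stem p (ts ⁺++⁺ us))
      valid = stem-valid-≃ (ts ⁺++⁺ us) F counts (AllVF-++ (toList ts) (toList us) Pts Pus) valid-F
      c≡ab : profile (stem p F) ≡ combination k a b
      c≡ab = profile-stem-combination p ts us F counts
      rps-ab : RelaxedPartialSolution I (combination k a b)
      rps-ab = subst (RelaxedPartialSolution I) c≡ab rps
      refute : ∀ a′ → ¬ Dominates I a′ a
      refute a′ dom with dominator-stem normalized ts Pts dom
      ... | ts′ , refl , valid′ =
        undominated _ (subst₂ (Dominates I) (sym (profile-stem-++ p ts′ us)) (sym c≡ab)
                                            (combination-dominates k a′ a b dom above rps-a′b rps-ab))
        where
        above : ∀ i → k F.< i → lookup a′ i ≡ lookup a i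
        above i k<i = trans (unbranched⇒profile≡1 (stem p ts′) (stem-unbranched p ts′) i k<i)
                            (sym (unbranched⇒profile≡1 (stem p ts) (stem-unbranched p ts) i k<i))
        rps-a′b : RelaxedPartialSolution I (combination k a′ b)
        rps-a′b = subst (RelaxedPartialSolution I) (profile-stem-++ p ts′ us)
                    (stem p (ts′ ⁺++⁺ us) ,
                     (k , stem-++-branching p ts′ us , graft-valid ts′ ts us (dominates⇒≤ dom) valid′ valid) ,
                     refl)

lemma4p3 : (I : Instance) → Normalized I →
    (c : Vec ℕ (suc (Instance.layers I))) → ParetoOptimal I c →
    1 < lookup c F.zero →
    (k : Fin (suc (Instance.layers I))) → Branching c k →
    Σ (Vec ℕ (suc (Instance.layers I))) λ a →
    Σ (Vec ℕ (suc (Instance.layers I))) λ b →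
      ParetoOptimal I a × ParetoOptimal I b
      × (lookup c F.zero ≤ 3 * lookup a F.zero)
      × (lookup c F.zero ≤ 3 * lookup b F.zero)
      × (Σ (Fin (suc (Instance.layers I))) λ ka →
         Σ (Fin (suc (Instance.layers I))) λ kb →
           Branching a ka × Branching b kb × toℕ ka ≤ toℕ k × toℕ kb ≤ toℕ k)
      × (c ≡ combination k a b)
lemma4p3 I normalized _ optimal@((t , (k′ , br′ , valid) , refl) , _) 1<c₀ k br
  with branching-unique (profile t) br′ br | ≤⇒≤′ (branching<root t br 1<c₀)
... | refl | p with stem-view p t (profile≤1⇒unbranched t (proj₁ br))
... | F , refl =
  let kA , brA , kA≤k = stem-branching p A
      kB , brB , kB≤k = stem-branching p B
  in profile (stem p A) , profile (stem p B) ,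
     stem-paretoOptimal I p normalized A B F counts P-part₁ P-part₂ valid optimal ,
     stem-paretoOptimal I p normalized B A F (≃-trans (++-comm-≃ (toList B) (toList A)) counts) P-part₂ P-part₁ valid optimal ,
     third A large₁ , third B large₂ , (kA , kB , brA , brB , kA≤k , kB≤k) ,
     profile-stem-combination p A B F counts
  where
  W : ℕ
  W = leavesF (toList F)
  c₀≡W : cnt 0 (stem p F) ≡ W
  c₀≡W = trans (cnt-zero (stem p F)) (leaves-stem p F)
  several : 1 < cntF (toℕ k) (toList F)
  several = subst (1 <_) (trans (lookup-profile (stem p F) k) (cnt-stem-≤ p F ≤-refl))
                  (branching-count (profile (stem p F)) br 1<c₀)
  open Balance W (subst (1 <_) c₀≡W 1<c₀) (Bounded I (toℕ k)) (Bounded-convex I)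
  open Partition (partition (toList F) refl several (proj₁ (AllV-stem⁻ p F (proj₁ (proj₂ valid)))))
  A B : List⁺ (LTree (toℕ k))
  A = part₁
  B = part₂
  third : (ts : List⁺ (LTree (toℕ k))) → Large (leavesF (toList ts)) → cnt 0 (stem p F) ≤ 3 * cnt 0 (stem p ts)
  third ts = subst₂ (λ x y → x ≤ 3 * y) (sym c₀≡W) (sym (trans (cnt-zero (stem p ts)) (leaves-stem p ts)))
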